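{- Let $p>3$ be a prime, $t\in \{1,3,p,3p\}$, and $1\leqslant r\leqslant 3p-1$ with $\gcd(r,3p)=1$. Then \[\Lambda(p,r,t)=\begin{cases} \{1\} & \text{if } r\equiv 2\pmod 3 \text{ and } |r|_p\text{ is odd},\\ \emptyset & \text{otherwise}. \end{cases}\]
   Context: $|r|_m$ is the multiplicative order of $r$ modulo $m$. $S_k(x)=1+x+\cdots+x^{k-1}$ for $k\ge1$, $S_0(x)=0$; for a positive integer $m$ with $\gcd(r,m)=1$, $\kappa(m,r,t)=\dfrac{m|r|_m}{\gcd(m,\ tS_{|r|_m}(r))}$. For a divisor $d$ of $3p$, $\Lambda(d,r,t)=\{\ell>0\mid \ell \text{ divides } \frac{|r|_{3p}}{\gcd(\kappa(d,r,t),|r|_{3p})} \text{ and } \gcd(r^{\ell\kappa(d,r,t)}-1,3p)=d\}$. -}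

module Defs where

open import Data.Nat using (ℕ; zero; suc; _+_; _*_; _∸_; _^_; _<_; _≡ᵇ_)
open import Data.Nat.DivMod using (_%_; _/_)
open import Data.Nat.GCD using (gcd)
open import Data.Nat.Divisibility using (_∣_)
open import Data.Bool using (if_then_else_)
open import Data.Product using (_×_)
open import Relation.Binary.PropositionalEquality using (_≡_)

ordAux : (m' r fuel start : ℕ) → ℕ
ordAux m' r zero    k = 0
ordAux m' r (suc f) k =
  if (r ^ k) % suc m' ≡ᵇ 1 % suc m' then k else ordAux m' r f (suc k)

-- multiplicative order |r|_m : least k ≥ 1 with r^k ≡ 1 (mod m).
-- For gcd(r,m)=1 and m ≥ 1 it exists and is ≤ m, so the search is exact.
ord : (r m : ℕ) → ℕ
ord r zero      = 0
ord r (suc m')  = ordAux m' r (suc m') 1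

S : ℕ → ℕ → ℕ
S zero    x = 0
S (suc k) x = S k x + x ^ k

-- division with the (unused) convention a / 0 = 0
_div_ : ℕ → ℕ → ℕ
a div zero    = 0
a div (suc b) = a / suc b

κ : (m r t : ℕ) → ℕ
κ m r t = (m * ord r m) div gcd m (t * S (ord r m) r)

-- membership ℓ ∈ Λ(d,r,t), relative to the prime p (modulus 3p)
Λ : (p d r t ℓ : ℕ) → Set
Λ p d r t ℓ =
  (0 < ℓ)
  × (ℓ ∣ (ord r (3 * p) div gcd (κ d r t) (ord r (3 * p))))
  × (gcd (r ^ (ℓ * κ d r t) ∸ 1) (3 * p) ≡ d)

{-# OPTIONS --safe #-}
module Submission where

-- Write o = |r|_p and K = κ(p,r,t). The gcd of p and t S_o(r) is 1 or p; in the first case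
-- p divides r^o - 1 = (r - 1) S_o(r) but not S_o(r), so r ≡ 1 (mod p) and o = 1. Hence
-- K = o, or K = p and o = 1: in both cases o ∣ K, and K is odd iff o is. So p always divides
-- r^(ℓK) - 1, and gcd(r^(ℓK) - 1, 3p) = p exactly when 3 ∤ r^(ℓK) - 1, i.e. when r ≡ 2 (mod 3)
-- and ℓK is odd. Then r^(2K) ≡ 1 modulo 3 and modulo p, so |r|_3p divides 2K, whence
-- |r|_3p / gcd(K, |r|_3p) divides 2, and its odd divisor ℓ is 1.

open import Defs
open import Data.Nat using (ℕ; _*_; _∸_; _<_; _≤_)
open import Data.Nat.DivMod using (_%_)
open import Data.Nat.GCD using (gcd)
open import Data.Nat.Primality using (Prime)
open import Data.Product using (_×_)
open import Data.Sum using (_⊎_)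
open import Function.Bundles using (_⇔_)
open import Relation.Binary.PropositionalEquality using (_≡_)

open import Data.Nat
  using (zero; suc; _+_; _^_; _≡ᵇ_; NonZero; z≤n; s≤s; >-nonZero; >-nonZero⁻¹; ≢-nonZero; ≢-nonZero⁻¹)
open import Data.Nat.Properties
open import Data.Nat.DivMod
  using (_/_; _mod_; m≡m%n+[m/n]*n; %-distribˡ-*; %-remove-+ʳ; m%n<n; n/1≡n; m*n/n≡m)
open import Data.Nat.Divisibility
open import Data.Nat.GCD using (gcd[m,n]∣m; gcd[m,n]∣n; gcd[m,n]≢0; gcd-greatest; c*gcd[m,n]≡gcd[cm,cn])
open import Data.Nat.LCM using (lcm; lcm-least; gcd*lcm)
open import Data.Nat.Coprimality as Coprime
  using (Coprime; coprime-divisor; gcd≡1⇒coprime; coprime⇒gcd≡1; 1-coprimeTo; prime⇒coprime)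
open import Data.Nat.Primality
  using (Irreducible; irreducible?; irreducible[2]; prime⇒irreducible; prime⇒nonZero)
open import Data.Nat.Tactic.RingSolver using (solve-∀)
open import Data.Bool using (true; false)
open import Data.Fin using (toℕ)
open import Data.Fin.Properties using (pigeonhole; fromℕ<-injective; toℕ<n)
open import Data.Product using (_,_; proj₂; ∃-syntax)
open import Data.Sum using (inj₁; inj₂; [_,_]′)
open import Function using (_∘_)
open import Function.Bundles using (Equivalence; mk⇔)
open import Relation.Nullary using (¬_; contradiction; proof; ofʸ; ofⁿ)
open import Relation.Nullary.Decidable using (from-yes)
open import Relation.Binary.PropositionalEquality using (refl; sym; trans; cong; cong₂; subst; module ≡-Reasoning)
open ≡-Reasoning

%≡%⇒∣∸ : ∀ a b m .{{_ : NonZero m}} → a % m ≡ b % m → m ∣ a ∸ b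
%≡%⇒∣∸ a b m a≡b = divides (a / m ∸ b / m) (begin
  a ∸ b                                      ≡⟨ cong₂ _∸_ (m≡m%n+[m/n]*n a m) (m≡m%n+[m/n]*n b m) ⟩
  (a % m + a / m * m) ∸ (b % m + b / m * m)  ≡⟨ cong (λ x → (a % m + a / m * m) ∸ (x + b / m * m)) a≡b ⟨
  (a % m + a / m * m) ∸ (a % m + b / m * m)  ≡⟨ [m+n]∸[m+o]≡n∸o (a % m) _ _ ⟩
  a / m * m ∸ b / m * m                      ≡⟨ *-distribʳ-∸ m (a / m) (b / m) ⟨
  (a / m ∸ b / m) * m                        ∎)

∣∸⇒%≡% : ∀ {a b} m .{{_ : NonZero m}} → b ≤ a → m ∣ a ∸ b → a % m ≡ b % m
∣∸⇒%≡% {a} {b} m b≤a m∣a∸b = begin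
  a % m             ≡⟨ cong (_% m) (m+[n∸m]≡n b≤a) ⟨
  (b + (a ∸ b)) % m ≡⟨ %-remove-+ʳ b m∣a∸b ⟩
  b % m             ∎

*-%≡1ʳ : ∀ a {b m} .{{_ : NonZero m}} → b % m ≡ 1 % m → a * b % m ≡ a % m
*-%≡1ʳ a {b} {m} b≡1 = begin
  a * b % m             ≡⟨ %-distribˡ-* a b m ⟩
  a % m * (b % m) % m   ≡⟨ cong (λ x → a % m * x % m) b≡1 ⟩
  a % m * (1 % m) % m   ≡⟨ %-distribˡ-* a 1 m ⟨
  a * 1 % m             ≡⟨ cong (_% m) (*-identityʳ a) ⟩
  a % m                 ∎

^-%≡1 : ∀ {a m} .{{_ : NonZero m}} → a % m ≡ 1 % m → ∀ q → a ^ q % m ≡ 1 % m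
^-%≡1 a≡1 zero        = refl
^-%≡1 {a} a≡1 (suc q) = trans (*-%≡1ʳ a (^-%≡1 a≡1 q)) a≡1

^-%≡1-∣ : ∀ {r k n m} .{{_ : NonZero m}} → r ^ k % m ≡ 1 % m → k ∣ n → r ^ n % m ≡ 1 % m
^-%≡1-∣ {r} {k} {m = m} rᵏ≡1 (divides q refl) = begin
  r ^ (q * k) % m  ≡⟨ cong (λ e → r ^ e % m) (*-comm q k) ⟩
  r ^ (k * q) % m  ≡⟨ cong (_% m) (^-*-assoc r k q) ⟨
  (r ^ k) ^ q % m  ≡⟨ ^-%≡1 rᵏ≡1 q ⟩
  1 % m            ∎

^-%-period : ∀ {r k m} .{{_ : NonZero m}} .{{_ : NonZero k}} → r ^ k % m ≡ 1 % m →
             ∀ n → r ^ n % m ≡ r ^ (n % k) % m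
^-%-period {r} {k} {m} rᵏ≡1 n = begin
  r ^ n % m                          ≡⟨ cong (λ e → r ^ e % m) (m≡m%n+[m/n]*n n k) ⟩
  r ^ (n % k + n / k * k) % m        ≡⟨ cong (_% m) (^-distribˡ-+-* r (n % k) (n / k * k)) ⟩
  r ^ (n % k) * r ^ (n / k * k) % m  ≡⟨ *-%≡1ʳ (r ^ (n % k)) (^-%≡1-∣ rᵏ≡1 (n∣m*n (n / k))) ⟩
  r ^ (n % k) % m                    ∎

coprime-^ : ∀ {m r} → Coprime m r → ∀ a → Coprime m (r ^ a)
coprime-^ {m} m⊥r zero                          = Coprime.sym (1-coprimeTo m)
coprime-^ {r = r} m⊥r (suc a) {d} (d∣m , d∣r*rᵃ) =
  coprime-^ m⊥r a (d∣m , coprime-divisor d⊥r d∣r*rᵃ)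
  where
  d⊥r : Coprime d r
  d⊥r (e∣d , e∣r) = m⊥r (∣-trans e∣d d∣m , e∣r)

*-cancelˡ-% : ∀ {m c x y} .{{_ : NonZero m}} → Coprime m c → c * x % m ≡ c * y % m → x % m ≡ y % m
*-cancelˡ-% {m} {c} {x} {y} m⊥c cx≡cy =
  [ (λ x≤y → sym (∣∸⇒%≡% m x≤y (m∣∸ y x (sym cx≡cy)))) , (λ y≤x → ∣∸⇒%≡% m y≤x (m∣∸ x y cx≡cy)) ]′
  (≤-total x y)
  where
  m∣∸ : ∀ u v → c * u % m ≡ c * v % m → m ∣ u ∸ v
  m∣∸ u v cu≡cv =
    coprime-divisor m⊥c (subst (m ∣_) (sym (*-distribˡ-∸ c u v)) (%≡%⇒∣∸ (c * u) (c * v) m cu≡cv))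

LeastFrom : (ℕ → Set) → ℕ → ℕ → Set
LeastFrom P k o = k ≤ o × P o × (∀ {s} → k ≤ s → s < o → ¬ P s)

LeastFrom-suc : ∀ {P k o} → ¬ P k → LeastFrom P (suc k) o → LeastFrom P k o
LeastFrom-suc {P} ¬Pk (k<o , Po , least) = <⇒≤ k<o , Po , least′
  where
  least′ : ∀ {s} → _ ≤ s → s < _ → ¬ P s
  least′ k≤s s<o with m≤n⇒m<n∨m≡n k≤s
  ... | inj₁ k<s  = least k<s s<o
  ... | inj₂ refl = ¬Pk

ordAux-least : ∀ m' r f k {j} → k ≤ j → j < k + f → r ^ j % suc m' ≡ 1 % suc m' →
               LeastFrom (λ s → r ^ s % suc m' ≡ 1 % suc m') k (ordAux m' r f k)
ordAux-least m' r zero k k≤j j<k+0 _ = contradiction (subst (_ <_) (+-identityʳ k) j<k+0) (≤⇒≯ k≤j)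
-- _≟_ on ℕ decides by _≡ᵇ_, so its proof reflects exactly the test made by ordAux.
ordAux-least m' r (suc f) k {j} k≤j j<k+1+f rʲ≡1
  with r ^ k % suc m' ≡ᵇ 1 % suc m' | proof (r ^ k % suc m' ≟ 1 % suc m')
... | true  | ofʸ rᵏ≡1 = ≤-refl , rᵏ≡1 , λ k≤s s<k → contradiction k≤s (<⇒≱ s<k)
... | false | ofⁿ rᵏ≢1 =
  LeastFrom-suc rᵏ≢1 (ordAux-least m' r f (suc k) k<j (subst (j <_) (+-suc k f) j<k+1+f) rʲ≡1)
  where
  k<j : k < j
  k<j = ≤∧≢⇒< k≤j (λ { refl → rᵏ≢1 rʲ≡1 })

∃-period : ∀ {m r} .{{_ : NonZero m}} → Coprime m r → ∃[ j ] 1 ≤ j × j ≤ m × r ^ j % m ≡ 1 % m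
∃-period {m} {r} m⊥r with i , j , i<j , rⁱ≡rʲ ← pigeonhole (n<1+n m) (λ i → r ^ toℕ i mod m)
  = toℕ j ∸ toℕ i , m<n⇒0<n∸m i<j , ≤-trans (m∸n≤m (toℕ j) (toℕ i)) (m<1+n⇒m≤n (toℕ<n j)) , rᵈ≡1
  where
  rᵈ≡1 : r ^ (toℕ j ∸ toℕ i) % m ≡ 1 % m
  rᵈ≡1 = *-cancelˡ-% (coprime-^ m⊥r (toℕ i)) (begin
    r ^ toℕ i * r ^ (toℕ j ∸ toℕ i) % m  ≡⟨ cong (_% m) (^-distribˡ-+-* r (toℕ i) (toℕ j ∸ toℕ i)) ⟨
    r ^ (toℕ i + (toℕ j ∸ toℕ i)) % m    ≡⟨ cong (λ e → r ^ e % m) (m+[n∸m]≡n (<⇒≤ i<j)) ⟩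
    r ^ toℕ j % m                        ≡⟨ fromℕ<-injective _ _ _ _ rⁱ≡rʲ ⟨
    r ^ toℕ i % m                        ≡⟨ cong (_% m) (*-identityʳ _) ⟨
    r ^ toℕ i * 1 % m                    ∎)

least-period-∣ : ∀ {m r o n} .{{_ : NonZero m}} → LeastFrom (λ s → r ^ s % m ≡ 1 % m) 1 o →
                 r ^ n % m ≡ 1 % m → o ∣ n
least-period-∣ {m} {r} {o} {n} (1≤o , rᵒ≡1 , least) rⁿ≡1 = m%n≡0⇒n∣m n o n%o≡0
  where
  instance
    o≢0 : NonZero o
    o≢0 = >-nonZero 1≤o
  n%o≡0 : n % o ≡ 0
  n%o≡0 = n≤0⇒n≡0 (≮⇒≥ λ 0<n%o →
    least 0<n%o (m%n<n n o) (trans (sym (^-%-period {k = o} rᵒ≡1 n)) rⁿ≡1))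

record IsOrder (m r o : ℕ) .{{_ : NonZero m}} : Set where
  field
    order>0   : 1 ≤ o
    pow-order : r ^ o % m ≡ 1 % m
    order∣    : ∀ {n} → r ^ n % m ≡ 1 % m → o ∣ n

ord-isOrder : ∀ {m r} .{{_ : NonZero m}} → Coprime m r → IsOrder m r (ord r m)
ord-isOrder {suc m'} {r} m⊥r with j , 1≤j , j≤m , rʲ≡1 ← ∃-period m⊥r
  with least@(1≤o , rᵒ≡1 , _) ← ordAux-least m' r (suc m') 1 1≤j (s≤s j≤m) rʲ≡1
  = record { order>0 = 1≤o ; pow-order = rᵒ≡1 ; order∣ = least-period-∣ least }

S-geometric : ∀ k x → S k x * (x ∸ 1) ≡ x ^ k ∸ 1
S-geometric zero    zero    = refl
S-geometric (suc k) zero    = *-zeroʳ (S (suc k) 0)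
S-geometric k       (suc x) = begin
  S k (suc x) * x          ≡⟨ m+n∸n≡m (S k (suc x) * x) 1 ⟨
  S k (suc x) * x + 1 ∸ 1  ≡⟨ cong (_∸ 1) (S-geometric⁺ k) ⟩
  suc x ^ k ∸ 1            ∎
  where
  step : ∀ a y → (a + (a * y + 1)) * y + 1 ≡ suc y * (a * y + 1)
  step = solve-∀
  S-geometric⁺ : ∀ k → S k (suc x) * x + 1 ≡ suc x ^ k
  S-geometric⁺ zero    = refl
  S-geometric⁺ (suc k) = begin
    (S k (suc x) + suc x ^ k) * x + 1            ≡⟨ cong (λ y → (S k (suc x) + y) * x + 1) (S-geometric⁺ k) ⟨
    (S k (suc x) + (S k (suc x) * x + 1)) * x + 1 ≡⟨ step (S k (suc x)) x ⟩
    suc x * (S k (suc x) * x + 1)                ≡⟨ cong (suc x *_) (S-geometric⁺ k) ⟩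
    suc x * suc x ^ k                            ∎

%2-cases : ∀ n → n % 2 ≡ 0 ⊎ n % 2 ≡ 1
%2-cases n with n % 2 | m%n<n n 2
... | 0 | _ = inj₁ refl
... | 1 | _ = inj₂ refl
... | suc (suc _) | s≤s (s≤s ())

%3-cases : ∀ n → n % 3 ≡ 0 ⊎ n % 3 ≡ 1 ⊎ n % 3 ≡ 2
%3-cases n with n % 3 | m%n<n n 3
... | 0 | _ = inj₁ refl
... | 1 | _ = inj₂ (inj₁ refl)
... | 2 | _ = inj₂ (inj₂ refl)
... | suc (suc (suc _)) | s≤s (s≤s (s≤s ()))

odd-*ˡ : ∀ m n → m * n % 2 ≡ 1 → m % 2 ≡ 1
odd-*ˡ m n mn-odd with %2-cases m
... | inj₂ m-odd  = m-odd
... | inj₁ m-even = contradiction (trans (sym mn-odd) (n∣m⇒m%n≡0 (m * n) 2 2∣mn)) λ ()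
  where 2∣mn = ∣m⇒∣m*n n (m%n≡0⇒n∣m m 2 m-even)

odd-*ʳ : ∀ m n → m * n % 2 ≡ 1 → n % 2 ≡ 1
odd-*ʳ m n = odd-*ˡ n m ∘ subst (λ x → x % 2 ≡ 1) (*-comm m n)

odd∣2⇒≡1 : ∀ {ℓ} → ℓ % 2 ≡ 1 → ℓ ∣ 2 → ℓ ≡ 1
odd∣2⇒≡1 ℓ-odd ℓ∣2 with irreducible[2] ℓ∣2
... | inj₁ ℓ≡1 = ℓ≡1
... | inj₂ refl = contradiction ℓ-odd λ ()

irreducible[3] : Irreducible 3
irreducible[3] = from-yes (irreducible? 3)

prime⇒∤ : ∀ {p d} → Prime p → 1 < d → d < p → ¬ d ∣ p
prime⇒∤ p-prime 1<d d<p d∣p with prime⇒irreducible p-prime d∣p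
... | inj₁ refl = <-irrefl refl 1<d
... | inj₂ refl = <-irrefl refl d<p

prime⇒odd : ∀ {p} → Prime p → 2 < p → p % 2 ≡ 1
prime⇒odd {p} p-prime 2<p with %2-cases p
... | inj₁ p-even = contradiction (m%n≡0⇒n∣m p 2 p-even) (prime⇒∤ p-prime (s≤s (s≤s z≤n)) 2<p)
... | inj₂ p-odd  = p-odd

coprime⇒*∣ : ∀ {m n x} → Coprime m n → m ∣ x → n ∣ x → m * n ∣ x
coprime⇒*∣ {m} {n} m⊥n m∣x n∣x = subst (_∣ _) lcm≡m*n (lcm-least m∣x n∣x)
  where
  lcm≡m*n : lcm m n ≡ m * n
  lcm≡m*n = begin
    lcm m n            ≡⟨ *-identityˡ (lcm m n) ⟨
    1 * lcm m n        ≡⟨ cong (_* lcm m n) (coprime⇒gcd≡1 m⊥n) ⟨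
    gcd m n * lcm m n  ≡⟨ gcd*lcm m n ⟩
    m * n              ∎

div≡/ : ∀ a b .{{_ : NonZero b}} → a div b ≡ a / b
div≡/ a (suc b) = refl

∣c*n⇒div-gcd∣c : ∀ {m n} c .{{_ : NonZero m}} → m ∣ c * n → m div gcd n m ∣ c
∣c*n⇒div-gcd∣c {m} {n} c m∣cn =
  subst (_∣ c) (sym (div≡/ m (gcd n m))) (m∣n*o⇒m/n∣o (gcd[m,n]∣n n m) m∣c*g)
  where
  instance
    g≢0 : NonZero (gcd n m)
    g≢0 = ≢-nonZero (gcd[m,n]≢0 n m (inj₂ (≢-nonZero⁻¹ m)))
  m∣c*g : m ∣ c * gcd n m
  m∣c*g = subst (m ∣_) (sym (c*gcd[m,n]≡gcd[cm,cn] c n m)) (gcd-greatest m∣cn (n∣m*n c))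

square-%3 : ∀ r → r % 3 ≡ 2 → r ^ 2 % 3 ≡ 1 % 3
square-%3 r r≡2 = begin
  r * (r * 1) % 3      ≡⟨ cong (λ y → r * y % 3) (*-identityʳ r) ⟩
  r * r % 3            ≡⟨ %-distribˡ-* r r 3 ⟩
  r % 3 * (r % 3) % 3  ≡⟨ cong₂ (λ a b → a * b % 3) r≡2 r≡2 ⟩
  2 * 2 % 3            ∎

3∤^∸1⇔ : ∀ {r} n .{{_ : NonZero r}} → ¬ 3 ∣ r → (¬ 3 ∣ r ^ n ∸ 1) ⇔ (r % 3 ≡ 2 × n % 2 ≡ 1)
3∤^∸1⇔ {r} n 3∤r = mk⇔ to from
  where
  3∣ : ∀ e → r ^ e % 3 ≡ 1 % 3 → 3 ∣ r ^ e ∸ 1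
  3∣ e = %≡%⇒∣∸ (r ^ e) 1 3
  to : ¬ 3 ∣ r ^ n ∸ 1 → r % 3 ≡ 2 × n % 2 ≡ 1
  to 3∤rⁿ∸1 with %3-cases r
  ... | inj₁ r≡0        = contradiction (m%n≡0⇒n∣m r 3 r≡0) 3∤r
  ... | inj₂ (inj₁ r≡1) = contradiction (3∣ n (^-%≡1 r≡1 n)) 3∤rⁿ∸1
  ... | inj₂ (inj₂ r≡2) with %2-cases n
  ...   | inj₁ n-even = contradiction (3∣ n rⁿ≡1) 3∤rⁿ∸1
    where
    rⁿ≡1 : r ^ n % 3 ≡ 1 % 3
    rⁿ≡1 = trans (^-%-period {k = 2} (square-%3 r r≡2) n) (cong (λ e → r ^ e % 3) n-even)
  ...   | inj₂ n-odd  = r≡2 , n-odd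
  from : r % 3 ≡ 2 × n % 2 ≡ 1 → ¬ 3 ∣ r ^ n ∸ 1
  from (r≡2 , n-odd) 3∣rⁿ∸1 = contradiction (begin
    1 % 3            ≡⟨ ∣∸⇒%≡% 3 (m^n>0 r n) 3∣rⁿ∸1 ⟨
    r ^ n % 3        ≡⟨ ^-%-period {k = 2} (square-%3 r r≡2) n ⟩
    r ^ (n % 2) % 3  ≡⟨ cong (λ e → r ^ e % 3) n-odd ⟩
    r * 1 % 3        ≡⟨ cong (_% 3) (*-identityʳ r) ⟩
    r % 3            ≡⟨ r≡2 ⟩
    2                ∎) λ ()

module _ {p : ℕ} (p-prime : Prime p) where
  private instance
    p≢0 : NonZero p
    p≢0 = prime⇒nonZero p-prime

  coprime-S⇒ord≡1 : ∀ {r} .{{_ : NonZero r}} → Coprime p r → Coprime p (S (ord r p) r) → ord r p ≡ 1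
  coprime-S⇒ord≡1 {r} p⊥r p⊥S = ∣1⇒≡1 (order∣ r¹≡1)
    where
    open IsOrder (ord-isOrder p⊥r)
    p∣r∸1 : p ∣ r ∸ 1
    p∣r∸1 = coprime-divisor p⊥S
      (subst (p ∣_) (sym (S-geometric (ord r p) r)) (%≡%⇒∣∸ (r ^ ord r p) 1 p pow-order))
    r¹≡1 : r ^ 1 % p ≡ 1 % p
    r¹≡1 = trans (cong (_% p) (*-identityʳ r)) (∣∸⇒%≡% p (>-nonZero⁻¹ r) p∣r∸1)

  κ-cases : ∀ {r} .{{_ : NonZero r}} t → Coprime p r → κ p r t ≡ ord r p ⊎ (κ p r t ≡ p × ord r p ≡ 1)
  κ-cases {r} t p⊥r with prime⇒irreducible p-prime (gcd[m,n]∣m p (t * S (ord r p) r))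
  ... | inj₂ G≡p = inj₁ (begin
    (p * ord r p) div gcd p (t * S (ord r p) r)  ≡⟨ cong ((p * ord r p) div_) G≡p ⟩
    (p * ord r p) div p                          ≡⟨ div≡/ (p * ord r p) p ⟩
    p * ord r p / p                              ≡⟨ cong (_/ p) (*-comm p (ord r p)) ⟩
    ord r p * p / p                              ≡⟨ m*n/n≡m (ord r p) p ⟩
    ord r p                                      ∎)
  ... | inj₁ G≡1 = inj₂ (κ≡p , o≡1)
    where
    o≡1 : ord r p ≡ 1
    o≡1 = coprime-S⇒ord≡1 p⊥r λ (d∣p , d∣S) → gcd≡1⇒coprime G≡1 (d∣p , ∣n⇒∣m*n t d∣S)
    κ≡p : κ p r t ≡ p
    κ≡p = begin
      (p * ord r p) div gcd p (t * S (ord r p) r)  ≡⟨ cong ((p * ord r p) div_) G≡1 ⟩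
      p * ord r p / 1                              ≡⟨ n/1≡n (p * ord r p) ⟩
      p * ord r p                                  ≡⟨ cong (p *_) o≡1 ⟩
      p * 1                                        ≡⟨ *-identityʳ p ⟩
      p                                            ∎

  gcd[x,3p]≡p⇔ : ∀ {x} → 3 < p → gcd x (3 * p) ≡ p ⇔ (p ∣ x × ¬ 3 ∣ x)
  gcd[x,3p]≡p⇔ {x} 3<p = mk⇔ to from
    where
    3∤p : ¬ 3 ∣ p
    3∤p = prime⇒∤ p-prime (s≤s (s≤s z≤n)) 3<p
    to : gcd x (3 * p) ≡ p → p ∣ x × ¬ 3 ∣ x
    to g≡p = subst (_∣ x) g≡p (gcd[m,n]∣m x (3 * p)) ,
             λ 3∣x → 3∤p (subst (3 ∣_) g≡p (gcd-greatest 3∣x (m∣m*n p)))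
    from : p ∣ x × ¬ 3 ∣ x → gcd x (3 * p) ≡ p
    from (p∣x , 3∤x) with gcd-greatest p∣x (n∣m*n 3)
    ... | divides c g≡c*p
      with irreducible[3] {c} (*-cancelʳ-∣ p (subst (_∣ 3 * p) g≡c*p (gcd[m,n]∣n x (3 * p))))
    ...   | inj₁ refl = trans g≡c*p (*-identityˡ p)
    ...   | inj₂ refl =
      contradiction (∣-trans (subst (3 ∣_) (sym g≡c*p) (m∣m*n p)) (gcd[m,n]∣m x (3 * p))) 3∤x

module _ {p r : ℕ} (p-prime : Prime p) (3<p : 3 < p) .{{_ : NonZero r}} (r⊥3p : Coprime r (3 * p)) (t : ℕ) where
  private
    instance
      p≢0 : NonZero p
      p≢0 = prime⇒nonZero p-prime
      3p≢0 : NonZero (3 * p)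
      3p≢0 = m*n≢0 3 p

    o = ord r p
    O = ord r (3 * p)
    K = κ p r t

    p⊥r : Coprime p r
    p⊥r (d∣p , d∣r) = r⊥3p (d∣r , ∣n⇒∣m*n 3 d∣p)

    module Oₚ  = IsOrder (ord-isOrder {p} p⊥r)
    module O₃ₚ = IsOrder (ord-isOrder {3 * p} (Coprime.sym r⊥3p))

    instance
      O≢0 : NonZero O
      O≢0 = >-nonZero O₃ₚ.order>0

  o∣K : o ∣ K
  o∣K with κ-cases p-prime t p⊥r
  ... | inj₁ K≡o      = ∣-reflexive (sym K≡o)
  ... | inj₂ (_ , o≡1) = subst (_∣ K) (sym o≡1) (1∣ K)

  K-odd⇔o-odd : K % 2 ≡ 1 ⇔ o % 2 ≡ 1
  K-odd⇔o-odd with κ-cases p-prime t p⊥r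
  ... | inj₁ K≡o = mk⇔ (subst (λ x → x % 2 ≡ 1) K≡o) (subst (λ x → x % 2 ≡ 1) (sym K≡o))
  ... | inj₂ (K≡p , o≡1) =
    mk⇔ (λ _ → cong (_% 2) o≡1) (λ _ → trans (cong (_% 2) K≡p) (prime⇒odd p-prime (<⇒≤ 3<p)))

  K∣⇒p∣r^∸1 : ∀ {n} → K ∣ n → p ∣ r ^ n ∸ 1
  K∣⇒p∣r^∸1 {n} K∣n = %≡%⇒∣∸ (r ^ n) 1 p (^-%≡1-∣ {r} {o} {n} {p} Oₚ.pow-order (∣-trans o∣K K∣n))

  gcd[r^ℓK∸1,3p]≡p⇔ : ∀ ℓ → gcd (r ^ (ℓ * K) ∸ 1) (3 * p) ≡ p ⇔ (r % 3 ≡ 2 × ℓ * K % 2 ≡ 1)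
  gcd[r^ℓK∸1,3p]≡p⇔ ℓ =
    mk⇔ (Equivalence.to 3∤⇔ ∘ proj₂ ∘ Equivalence.to gcd⇔)
        (λ h → Equivalence.from gcd⇔ (K∣⇒p∣r^∸1 (n∣m*n ℓ) , Equivalence.from 3∤⇔ h))
    where
    gcd⇔ = gcd[x,3p]≡p⇔ p-prime 3<p
    3∤⇔ = 3∤^∸1⇔ (ℓ * K) (λ 3∣r → contradiction (r⊥3p (3∣r , m∣m*n p)) λ ())

  O∣2K : r % 3 ≡ 2 → O ∣ 2 * K
  O∣2K r≡2 =
    O₃ₚ.order∣ (∣∸⇒%≡% (3 * p) (m^n>0 r (2 * K)) (coprime⇒*∣ 3⊥p 3∣ (K∣⇒p∣r^∸1 (n∣m*n 2))))
    where
    3⊥p : Coprime 3 p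
    3⊥p = Coprime.sym (prime⇒coprime p-prime 3<p)
    3∣ : 3 ∣ r ^ (2 * K) ∸ 1
    3∣ = %≡%⇒∣∸ (r ^ (2 * K)) 1 3 (^-%≡1-∣ {k = 2} (square-%3 r r≡2) (m∣m*n K))

  Λ[p]⇔ : ∀ ℓ → Λ p p r t ℓ ⇔ ((r % 3 ≡ 2 × o % 2 ≡ 1) × ℓ ≡ 1)
  Λ[p]⇔ ℓ = mk⇔ to from
    where
    to : Λ p p r t ℓ → (r % 3 ≡ 2 × o % 2 ≡ 1) × ℓ ≡ 1
    to (_ , ℓ∣O/g , g≡p) with r≡2 , ℓK-odd ← Equivalence.to (gcd[r^ℓK∸1,3p]≡p⇔ ℓ) g≡p =
      (r≡2 , Equivalence.to K-odd⇔o-odd (odd-*ʳ ℓ K ℓK-odd)) ,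
      odd∣2⇒≡1 (odd-*ˡ ℓ K ℓK-odd) (∣-trans ℓ∣O/g (∣c*n⇒div-gcd∣c {n = K} 2 (O∣2K r≡2)))
    from : (r % 3 ≡ 2 × o % 2 ≡ 1) × ℓ ≡ 1 → Λ p p r t ℓ
    from ((r≡2 , o-odd) , refl) =
      s≤s z≤n , 1∣ _ , Equivalence.from (gcd[r^ℓK∸1,3p]≡p⇔ 1) (r≡2 , 1K-odd)
      where
      1K-odd : 1 * K % 2 ≡ 1
      1K-odd = subst (λ x → x % 2 ≡ 1) (sym (*-identityˡ K)) (Equivalence.from K-odd⇔o-odd o-odd)

lemma5p4 : (p t r : ℕ) → Prime p → 3 < p →
    (t ≡ 1 ⊎ t ≡ 3 ⊎ t ≡ p ⊎ t ≡ 3 * p) →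
    1 ≤ r → r ≤ 3 * p ∸ 1 → gcd r (3 * p) ≡ 1 →
    (ℓ : ℕ) → (Λ p p r t ℓ ⇔ ((r % 3 ≡ 2 × ord r p % 2 ≡ 1) × ℓ ≡ 1))
lemma5p4 p t r p-prime 3<p _ 1≤r _ gcd≡1 = Λ[p]⇔ p-prime 3<p {{>-nonZero 1≤r}} (gcd≡1⇒coprime gcd≡1) t
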